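{- Let $\Delta$ be a bi-transitive bipartite digraph satisfying properties N3 and N4. Let $u$ and $v$ be non-equivalent vertices of $\Delta$ with a common out-neighbour. If there is no directed path of length $2$ from $u$ to $v$ and none from $v$ to $u$, then at least one of $u,v$ is not an endpoint of a symmetric edge.
   Context: Digraphs have no loops or multiple edges; $N(x)$, $N^-(x)$ are the out- and in-neighbourhoods of $x$, $N(S)=\bigcup_{s\in S}N(s)$. A bipartite digraph has two colour classes with every edge joining different classes; it is bi-transitive if whenever $u_1v_1,v_1u_2,u_2v_2$ are edges, $u_1v_2$ is an edge. Vertices $x,y$ are equivalent if $N(x)=N(y)$ and $N^-(x)=N^-(y)$. A symmetric edge is a pair $\{x,y\}$ with both $xy$ and $yx$ edges. N3: for any two vertices $x,y$ with $x\notin N(N(y))$, $y\notin N(N(x))$ and $N(x)\cap N(y)\ne\emptyset$, we have $N^-(x)=N^-(y)$ and either $N(x)\subseteq N(y)$ or $N(y)\subseteq N(x)$. N4: every vertex has at least one out-neighbour. -}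

module Defs where

open import Level using (Level; _⊔_; suc)
open import Data.Bool using (Bool)
open import Data.Product using (Σ; ∃; _×_; _,_)
open import Data.Sum using (_⊎_)
open import Relation.Nullary using (¬_)
open import Relation.Binary.PropositionalEquality using (_≢_)

record Digraph (a b : Level) : Set (suc (a ⊔ b)) where
  field
    V     : Set a
    E     : V → V → Set b
    loopless : ∀ x → ¬ E x x

module _ {a b : Level} (Δ : Digraph a b) where
  open Digraph Δ

  _∈N_ : V → V → Set b
  y ∈N x = E x y

  _∈N⁻_ : V → V → Set b
  y ∈N⁻ x = E y x

  _∈NN_ : V → V → Set (a ⊔ b)
  x ∈NN y = ∃ λ z → E y z × E z x

  NSub : V → V → Set (a ⊔ b)
  NSub x y = ∀ z → E x z → E y z

  NEq : V → V → Set (a ⊔ b)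
  NEq x y = NSub x y × NSub y x

  InEq : V → V → Set (a ⊔ b)
  InEq x y = (∀ z → E z x → E z y) × (∀ z → E z y → E z x)

  CommonOut : V → V → Set (a ⊔ b)
  CommonOut x y = ∃ λ z → E x z × E y z

  Equivalent : V → V → Set (a ⊔ b)
  Equivalent x y = NEq x y × InEq x y

  Bipartite : Set (a ⊔ b)
  Bipartite = Σ (V → Bool) λ c → ∀ x y → E x y → c x ≢ c y

  BiTransitive : Set (a ⊔ b)
  BiTransitive = ∀ u₁ v₁ u₂ v₂ → E u₁ v₁ → E v₁ u₂ → E u₂ v₂ → E u₁ v₂

  N3 : Set (a ⊔ b)
  N3 = ∀ x y → ¬ (x ∈NN y) → ¬ (y ∈NN x) → CommonOut x y →
       InEq x y × (NSub x y ⊎ NSub y x)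

  N4 : Set (a ⊔ b)
  N4 = ∀ x → ∃ λ y → E x y

  SymEndpoint : V → Set (a ⊔ b)
  SymEndpoint x = ∃ λ y → E x y × E y x

module Submission where

open import Defs
open import Level using (Level)
open import Data.Product using (_×_; _,_; proj₂)
open import Data.Sum using (inj₁; inj₂)
open import Relation.Nullary using (¬_)

∈NN-of-NSub : {a b : Level} (Δ : Digraph a b) {x y : Digraph.V Δ} →
  NSub Δ x y → SymEndpoint Δ x → _∈NN_ Δ x y
∈NN-of-NSub Δ x⊆y (z , xz , zx) = z , x⊆y z xz , zx

proposition4 : {a b : Level} (Δ : Digraph a b) →
    Bipartite Δ → BiTransitive Δ → N3 Δ → N4 Δ →
    (u v : Digraph.V Δ) →
    ¬ Equivalent Δ u v →
    CommonOut Δ u v →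
    ¬ (_∈NN_ Δ v u) → ¬ (_∈NN_ Δ u v) →
    ¬ (SymEndpoint Δ u × SymEndpoint Δ v)
proposition4 Δ _ _ n3 _ u v _ common v∉NNu u∉NNv (symU , symV)
  with proj₂ (n3 u v u∉NNv v∉NNu common)
... | inj₁ u⊆v = u∉NNv (∈NN-of-NSub Δ u⊆v symU)
... | inj₂ v⊆u = v∉NNu (∈NN-of-NSub Δ v⊆u symV)
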